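{- Let $T$ be a tree with $n\ge1$ vertices, let $t\ge1$ be an integer, and let $c$ be a $(t+1)$-dilated configuration on $T$. Then there exists a minimally self-reachable configuration $s$ on $T$ such that $c-s$ is $t$-dilated on $T$.
   Context: Label the vertices $v_1,\dots,v_n$. A chip configuration on $T$ is a vector $c\in\mathbb{Z}_{\ge0}^n$ ($c_i$ chips on $v_i$); the number of chips on a subtree is the sum of entries over its vertices. A subtree is a nonempty connected subgraph. For $t\ge1$, a configuration is $t$-dilated on $T$ if it has at least $t(m-1)$ chips on every $m$-vertex subtree of $T$. The Laplacian $\Delta(T)$ has $\Delta_{ii}=\deg(v_i)$, $\Delta_{ij}=-1$ if $v_iv_j$ is an edge, $0$ otherwise; firing $v_i$ from $c$ produces $c-\Delta(T)e_i$, legal if $c_i\ge\deg(v_i)$. A configuration is self-reachable on $T$ if some nonempty finite sequence of legal firings starting from it returns to it. (Known: self-reachable is equivalent to $1$-dilated.) A minimally self-reachable configuration is a self-reachable configuration with exactly $n-1$ chips. -}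

module Defs where

open import Data.Nat using (ℕ; zero; suc; _+_; _*_; _∸_; _≤_; _<_)
open import Data.Bool using (Bool; true; false; T; if_then_else_)
open import Data.Fin using (Fin; _≟_)
open import Data.Vec using (Vec; lookup; tabulate; updateAt; zipWith)
open import Data.List using (List; []; _∷_; length; sum)
open import Data.List.Relation.Unary.Unique.Propositional using (Unique)
open import Data.List.Relation.Unary.All using (All)
open import Data.Vec.Functional using () renaming (foldr to vfoldr)
open import Data.Product using (Σ; _×_; ∃; ∃-syntax)
open import Relation.Binary.PropositionalEquality using (_≡_; _≢_)
open import Relation.Binary.Construct.Closure.Transitive using (TransClosure)
open import Relation.Nullary using (¬_)
open import Relation.Nullary.Decidable using (⌊_⌋)

record Graph (n : ℕ) : Set where
  field
    adj       : Fin n → Fin n → Bool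
    symmetric : ∀ i j → adj i j ≡ adj j i
    irreflex  : ∀ i → adj i i ≡ false
open Graph public

Adj : ∀ {n} → Graph n → Fin n → Fin n → Set
Adj G i j = T (adj G i j)

data WalkIn {n} (G : Graph n) (S : Fin n → Set) : Fin n → Fin n → Set where
  here : ∀ {u} → S u → WalkIn G S u u
  step : ∀ {u w v} → S u → Adj G u w → WalkIn G S w v → WalkIn G S u v

data Chain {n} (G : Graph n) : List (Fin n) → Set where
  nil  : Chain G []
  one  : ∀ {u} → Chain G (u ∷ [])
  cons : ∀ {u w vs} → Adj G u w → Chain G (w ∷ vs) → Chain G (u ∷ w ∷ vs)

data LastAdj {n} (G : Graph n) (u : Fin n) : List (Fin n) → Set where
  lst  : ∀ {v} → Adj G v u → LastAdj G u (v ∷ [])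
  more : ∀ {v w vs} → LastAdj G u (w ∷ vs) → LastAdj G u (v ∷ w ∷ vs)

IsCycle : ∀ {n} → Graph n → List (Fin n) → Set
IsCycle G []                    = Data.Empty.⊥ where import Data.Empty
IsCycle G (u ∷ [])              = Data.Empty.⊥ where import Data.Empty
IsCycle G (u ∷ w ∷ [])          = Data.Empty.⊥ where import Data.Empty
IsCycle G (u ∷ w ∷ x ∷ rest)    =
  Unique (u ∷ w ∷ x ∷ rest) × Chain G (u ∷ w ∷ x ∷ rest) × LastAdj G u (u ∷ w ∷ x ∷ rest)

Connected : ∀ {n} → Graph n → Set
Connected G = ∀ u v → WalkIn G (λ _ → Data.Unit.⊤) u v where import Data.Unit

Acyclic : ∀ {n} → Graph n → Set
Acyclic G = ∀ cyc → ¬ IsCycle G cyc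

IsTree : ∀ {n} → Graph n → Set
IsTree G = Connected G × Acyclic G

ΣV : ∀ {n} → (Fin n → ℕ) → ℕ
ΣV f = vfoldr _+_ 0 f

degree : ∀ {n} → Graph n → Fin n → ℕ
degree G i = ΣV (λ j → if adj G i j then 1 else 0)

-- A subtree is a nonempty vertex set whose induced subgraph is connected
-- (for a tree, connected subgraphs are exactly induced on such sets,
-- and the chip count only depends on the vertex set).

Subset : ℕ → Set
Subset n = Fin n → Bool

size : ∀ {n} → Subset n → ℕ
size S = ΣV (λ i → if S i then 1 else 0)

IsSubtree : ∀ {n} → Graph n → Subset n → Set
IsSubtree G S = (∃[ i ] T (S i)) × (∀ u v → T (S u) → T (S v) → WalkIn G (λ x → T (S x)) u v)

Config : ℕ → Set
Config n = Vec ℕ n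

chipsOn : ∀ {n} → Config n → Subset n → ℕ
chipsOn c S = ΣV (λ i → if S i then lookup c i else 0)

total : ∀ {n} → Config n → ℕ
total c = ΣV (lookup c)

Dilated : ∀ {n} → ℕ → Graph n → Config n → Set
Dilated t G c = ∀ S → IsSubtree G S → t * (size S ∸ 1) ≤ chipsOn c S

-- Firing vertex i: c - Δ e_i (only used when legal, so ∸ is exact).
fire : ∀ {n} → Graph n → Config n → Fin n → Config n
fire G c i = tabulate λ j →
  if ⌊ j ≟ i ⌋ then lookup c i ∸ degree G i
  else (if adj G i j then suc (lookup c j) else lookup c j)

data LegalFire {n} (G : Graph n) : Config n → Config n → Set where
  fireAt : ∀ {c} i → degree G i ≤ lookup c i → LegalFire G c (fire G c i)

SelfReachable : ∀ {n} → Graph n → Config n → Set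
SelfReachable G c = TransClosure (LegalFire G) c c

MinSelfReachable : ∀ {n} → Graph n → Config n → Set
MinSelfReachable {n} G s = SelfReachable G s × total s ≡ n ∸ 1

-- Pointwise s ≤ c (so that c - s is again a configuration in ℤ≥0^n).
_≤ᶜ_ : ∀ {n} → Config n → Config n → Set
s ≤ᶜ c = ∀ i → lookup s i ≤ lookup c i

_-ᶜ_ : ∀ {n} → Config n → Config n → Config n
c -ᶜ s = zipWith _∸_ c s

{-# OPTIONS --safe #-}
module Submission where

-- Peel leaves.  For a subtree U with a leaf ℓ whose neighbour is p, split c = s + d on U,
-- where s has |U| - 1 chips, all on U, and a firing order in which every vertex holds at least
-- as many chips as it has neighbours fired after it, and d is t-dilated on U.
-- If c ℓ > t, split c on U - ℓ and give s one more chip, on ℓ, fired first (it pays for p);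
-- d keeps c ℓ - 1 ≥ t chips on ℓ.
-- If c ℓ + r = t, the (t + 1)-dilated edge {ℓ, p} gives c p ≥ r + 1.  Split on U - ℓ the
-- configuration left with c p - r - 1 chips on p, which is still (t + 1)-dilated there; then s
-- gets one more chip on p, which pays for ℓ fired last, and d gets the other r.  Either way a
-- subtree through ℓ carries t more chips of d than its part in U - ℓ carries in the smaller split.

open import Defs
open import Data.Bool using (true; false; T; if_then_else_)
open import Data.Bool.Properties using (T-≡)
open import Data.Empty using (⊥-elim)
open import Data.Fin using (Fin; _≟_) renaming (zero to fzero; suc to fsuc)
open import Data.Fin.Properties using () renaming (any? to ∃?; suc-injective to fsuc-injective)
open import Data.List using (List; []; _∷_; _++_; _∷ʳ_; [_]; length)
open import Data.List.Properties using (++-assoc)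
open import Data.List.Membership.Propositional using (_∈_)
open import Data.List.Membership.Propositional.Properties using (∈-∃++)
open import Data.List.Relation.Unary.All as All using (All; []; _∷_)
open import Data.List.Relation.Unary.All.Properties using (¬Any⇒All¬; ++⁻ˡ)
open import Data.List.Relation.Unary.AllPairs using ([]; _∷_)
open import Data.List.Relation.Unary.Any using (any?)
open import Data.List.Relation.Unary.Unique.Propositional using (Unique)
open import Data.Nat using (ℕ; zero; suc; _+_; _*_; _∸_; _≤_; z≤n; s≤s; _≤?_)
open import Data.Nat.Properties hiding (_≟_)
open import Algebra.Properties.CommutativeMonoid.Sum +-0-commutativeMonoid using (sum-cong-≗; sum-replicate-zero)
open import Algebra.Properties.CommutativeSemigroup +-commutativeSemigroup using (x∙yz≈y∙xz)
open import Data.Nat.Tactic.RingSolver using (solve-∀)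
open import Data.Product using (_×_; _,_; proj₁; proj₂; ∃₂; ∃-syntax)
open import Data.Sum using (_⊎_; inj₁; inj₂)
open import Data.Vec using (lookup; tabulate)
open import Data.Vec.Properties using (lookup∘tabulate; tabulate∘lookup; tabulate-cong; lookup-zipWith)
open import Function using (_∘_)
open import Function.Bundles using (Equivalence)
open import Relation.Binary.Construct.Closure.Transitive as Plus using (TransClosure; _∷_)
open import Relation.Binary.PropositionalEquality hiding ([_])
open import Relation.Nullary using (¬_; yes; no; contradiction)
open import Relation.Nullary.Decidable using (⌊_⌋; T?; ¬?; _×-dec_; decidable-stable)

if-T : ∀ {a} {A : Set a} {b} {x y : A} → T b → (if b then x else y) ≡ x
if-T {b = true} _ = refl

∸-+-cancel : ∀ {a b c d} → d ≤ a → a + b ≡ c + d → a ∸ d + b ≡ c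
∸-+-cancel {a} {b} {c} {d} d≤a eq = +-cancelʳ-≡ d _ _ (begin
  a ∸ d + b + d   ≡⟨ +-assoc (a ∸ d) b d ⟩
  a ∸ d + (b + d) ≡⟨ cong (a ∸ d +_) (+-comm b d) ⟩
  a ∸ d + (d + b) ≡⟨ +-assoc (a ∸ d) d b ⟨
  a ∸ d + d + b   ≡⟨ cong (_+ b) (m∸n+n≡m d≤a) ⟩
  a + b           ≡⟨ eq ⟩
  c + d           ∎)
  where open ≡-Reasoning

Unique-++⁻ˡ : ∀ {A : Set} (xs : List A) {ys} → Unique (xs ++ ys) → Unique xs
Unique-++⁻ˡ []       _              = []
Unique-++⁻ˡ (x ∷ xs) (x∉ ∷ unique) = ++⁻ˡ xs x∉ ∷ Unique-++⁻ˡ xs unique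

m≤1⇒k*[m∸1]≤n : ∀ k {m} x → m ≤ 1 → k * (m ∸ 1) ≤ x
m≤1⇒k*[m∸1]≤n k x m≤1 = subst (_≤ x) (sym (trans (cong (k *_) (m≤n⇒m∸n≡0 m≤1)) (*-zeroʳ k))) z≤n

module _ {a} {A : Set a} {n : ℕ} where

  infixl 6 _[_]≔_

  _[_]≔_ : (Fin n → A) → Fin n → A → Fin n → A
  (f [ q ]≔ v) i = if ⌊ i ≟ q ⌋ then v else f i

  []≔-updates : ∀ (f : Fin n → A) q {v} → (f [ q ]≔ v) q ≡ v
  []≔-updates f q with q ≟ q
  ... | yes _   = refl
  ... | no q≢q = contradiction refl q≢q

  []≔-minimal : ∀ (f : Fin n → A) {q i v} → i ≢ q → (f [ q ]≔ v) i ≡ f i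
  []≔-minimal f {q} {i} i≢q with i ≟ q
  ... | yes i≡q = contradiction i≡q i≢q
  ... | no _    = refl

module _ {n : ℕ} where

  ∅ : Subset n
  ∅ _ = false

  full : Subset n
  full _ = true

  infixl 6 _─_ _∪⁅_⁆

  _─_ : Subset n → Fin n → Subset n
  S ─ q = S [ q ]≔ false

  _∪⁅_⁆ : Subset n → Fin n → Subset n
  S ∪⁅ q ⁆ = S [ q ]≔ true

  ⁅_⁆ : Fin n → Subset n
  ⁅ q ⁆ = ∅ ∪⁅ q ⁆

  infix 4 _⊆_

  _⊆_ : Subset n → Subset n → Set
  S ⊆ U = ∀ i → T (S i) → T (U i)

  Empty : Subset n → Set
  Empty S = ∀ i → S i ≡ false

  ∉-─ : ∀ S q → (S ─ q) q ≡ false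
  ∉-─ S q = []≔-updates S q

  ∈-─⁺ : ∀ S {q i} → i ≢ q → T (S i) → T ((S ─ q) i)
  ∈-─⁺ S i≢q i∈S = subst T (sym ([]≔-minimal S i≢q)) i∈S

  ∈-─⁻ : ∀ S {q i} → T ((S ─ q) i) → i ≢ q × T (S i)
  ∈-─⁻ S {q} {i} i∈S─q with i ≟ q
  ... | no i≢q = i≢q , i∈S─q

  ─-⊆ : ∀ S q → S ─ q ⊆ S
  ─-⊆ S q i = proj₂ ∘ ∈-─⁻ S

  ∈-∪⁅⁆ : ∀ S q → T ((S ∪⁅ q ⁆) q)
  ∈-∪⁅⁆ S q = subst T (sym ([]≔-updates S q)) _

  ∪⁅⁆-⊇ : ∀ S q → S ⊆ S ∪⁅ q ⁆
  ∪⁅⁆-⊇ S q i i∈S with i ≟ q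
  ... | yes _ = _
  ... | no _  = i∈S

  ∈-∪⁅⁆⁻ : ∀ S {q i} → T ((S ∪⁅ q ⁆) i) → i ≡ q ⊎ T (S i)
  ∈-∪⁅⁆⁻ S {q} {i} i∈ with i ≟ q
  ... | yes i≡q = inj₁ i≡q
  ... | no _    = inj₂ i∈

ΣV-mono : ∀ {n} {f g : Fin n → ℕ} → (∀ i → f i ≤ g i) → ΣV f ≤ ΣV g
ΣV-mono {zero}  _   = z≤n
ΣV-mono {suc n} f≤g = +-mono-≤ (f≤g fzero) (ΣV-mono (f≤g ∘ fsuc))

ΣV-split : ∀ {n} {f g : Fin n → ℕ} q → g q ≡ 0 → (∀ i → i ≢ q → f i ≡ g i) →
           ΣV f ≡ f q + ΣV g
ΣV-split {suc n} {f} {g} fzero gq≡0 agree =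
  cong₂ (λ x y → f fzero + (x + y)) (sym gq≡0) (sum-cong-≗ λ i → agree (fsuc i) λ ())
ΣV-split {suc n} {f} {g} (fsuc q) gq≡0 agree = begin
  f fzero + ΣV (f ∘ fsuc)
    ≡⟨ cong (f fzero +_) (ΣV-split q gq≡0 λ i i≢q → agree (fsuc i) (i≢q ∘ fsuc-injective)) ⟩
  f fzero + (f (fsuc q) + ΣV (g ∘ fsuc))
    ≡⟨ x∙yz≈y∙xz (f fzero) (f (fsuc q)) _ ⟩
  f (fsuc q) + (f fzero + ΣV (g ∘ fsuc))
    ≡⟨ cong (λ x → f (fsuc q) + (x + ΣV (g ∘ fsuc))) (agree fzero λ ()) ⟩
  f (fsuc q) + ΣV g ∎
  where open ≡-Reasoning

module _ {n : ℕ} where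

  -- Definitionally, chipsOn c = chips (lookup c) and size = chips (λ _ → 1).
  chips : (Fin n → ℕ) → Subset n → ℕ
  chips f S = ΣV λ i → if S i then f i else 0

  raise : (Fin n → ℕ) → Fin n → ℕ → Fin n → ℕ
  raise f q r = f [ q ]≔ (r + f q)

  chips-congˡ : ∀ {f g} S → (∀ i → T (S i) → f i ≡ g i) → chips f S ≡ chips g S
  chips-congˡ S f≡g = sum-cong-≗ λ i → pointwise (S i) (f≡g i)
    where
    pointwise : ∀ b {x y} → (T b → x ≡ y) → (if b then x else 0) ≡ (if b then y else 0)
    pointwise true  eq = eq _
    pointwise false _  = refl

  chips-monoˡ : ∀ {f g} S → (∀ i → T (S i) → f i ≤ g i) → chips f S ≤ chips g S
  chips-monoˡ S f≤g = ΣV-mono λ i → pointwise (S i) (f≤g i)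
    where
    pointwise : ∀ b {x y} → (T b → x ≤ y) → (if b then x else 0) ≤ (if b then y else 0)
    pointwise true  le = le _
    pointwise false _  = z≤n

  chips-monoʳ : ∀ f {S S'} → S ⊆ S' → chips f S ≤ chips f S'
  chips-monoʳ f {S} {S'} S⊆S' = ΣV-mono λ i → pointwise i (S i) (S' i) (S⊆S' i)
    where
    pointwise : ∀ i b b' → (T b → T b') → (if b then f i else 0) ≤ (if b' then f i else 0)
    pointwise i true  true  _  = ≤-refl
    pointwise i true  false ⊆  = ⊥-elim (⊆ _)
    pointwise i false _     _  = z≤n

  chips-vanishing : ∀ f S → (∀ i → T (S i) → f i ≡ 0) → chips f S ≡ 0
  chips-vanishing f S vanish = trans (sum-cong-≗ λ i → pointwise (S i) (vanish i)) (sum-replicate-zero n)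
    where
    pointwise : ∀ b {x} → (T b → x ≡ 0) → (if b then x else 0) ≡ 0
    pointwise true  x≡0 = x≡0 _
    pointwise false _   = refl

  chips-∅ : ∀ f {S} → Empty S → chips f S ≡ 0
  chips-∅ f {S} empty = chips-vanishing f S λ i i∈S → ⊥-elim (subst T (empty i) i∈S)

  chips-insert : ∀ f {R R'} q → R q ≡ false → T (R' q) → (∀ i → i ≢ q → R' i ≡ R i) →
                 chips f R' ≡ f q + chips f R
  chips-insert f q q∉R q∈R' agree = trans
    (ΣV-split q (cong (λ b → if b then f q else 0) q∉R)
      λ i i≢q → cong (λ b → if b then f i else 0) (agree i i≢q))
    (cong (_+ _) (if-T q∈R'))

  chips-─ : ∀ f S q → T (S q) → chips f S ≡ f q + chips f (S ─ q)
  chips-─ f S q q∈S = chips-insert f q (∉-─ S q) q∈S λ i i≢q → sym ([]≔-minimal S i≢q)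

  chips-⁅⁆ : ∀ f q → chips f ⁅ q ⁆ ≡ f q
  chips-⁅⁆ f q = trans (chips-insert f q refl (∈-∪⁅⁆ ∅ q) λ i i≢q → []≔-minimal ∅ i≢q)
                       (trans (cong (f q +_) (chips-∅ f λ _ → refl)) (+-identityʳ (f q)))

  chips-[]≔ : ∀ f S q {v} → T (S q) → chips (f [ q ]≔ v) S ≡ v + chips f (S ─ q)
  chips-[]≔ f S q {v} q∈S = begin
    chips (f [ q ]≔ v) S               ≡⟨ chips-─ _ S q q∈S ⟩
    (f [ q ]≔ v) q + chips (f [ q ]≔ v) (S ─ q)
      ≡⟨ cong₂ _+_ ([]≔-updates f q) (chips-congˡ (S ─ q) λ i i∈ → []≔-minimal f (proj₁ (∈-─⁻ S i∈))) ⟩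
    v + chips f (S ─ q)                 ∎
    where open ≡-Reasoning

  chips-raise : ∀ f S q r → T (S q) → chips (raise f q r) S ≡ r + chips f S
  chips-raise f S q r q∈S = begin
    chips (raise f q r) S        ≡⟨ chips-[]≔ f S q q∈S ⟩
    (r + f q) + chips f (S ─ q)  ≡⟨ +-assoc r (f q) _ ⟩
    r + (f q + chips f (S ─ q))  ≡⟨ cong (r +_) (chips-─ f S q q∈S) ⟨
    r + chips f S                ∎
    where open ≡-Reasoning

  raise-≥ : ∀ f q r i → f i ≤ raise f q r i
  raise-≥ f q r i with i ≟ q
  ... | yes refl = m≤n+m (f i) r
  ... | no _     = ≤-refl

  size-─ : ∀ S q → T (S q) → size S ≡ suc (size (S ─ q))
  size-─ = chips-─ λ _ → 1

  size≡0⇒Empty : ∀ S → size S ≡ 0 → Empty S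
  size≡0⇒Empty S size≡0 i with S i in i∈S
  ... | false = refl
  ... | true  = contradiction (trans (sym (size-─ S i (Equivalence.from T-≡ i∈S))) size≡0) λ ()

  size≡suc⇒nonempty : ∀ {k} S → size S ≡ suc k → ∃[ i ] T (S i)
  size≡suc⇒nonempty S size≡ with ∃? (T? ∘ S)
  ... | yes i∈S = i∈S
  ... | no  S≡∅ = contradiction (trans (sym size≡) (chips-∅ _ empty)) λ ()
    where
    empty : Empty S
    empty i with S i in i∈S
    ... | false = refl
    ... | true  = contradiction (i , Equivalence.from T-≡ i∈S) S≡∅

  unique⇒length≤size : ∀ (U : Subset n) {xs} → Unique xs → All (T ∘ U) xs → length xs ≤ size U
  unique⇒length≤size U []                  []                  = z≤n
  unique⇒length≤size U {x ∷ xs} (x∉xs ∷ unique) (x∈U ∷ xs⊆U) = begin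
    suc (length xs)    ≤⟨ s≤s (unique⇒length≤size (U ─ x) unique xs⊆U─x) ⟩
    suc (size (U ─ x)) ≡⟨ size-─ U x x∈U ⟨
    size U             ∎
    where
    open ≤-Reasoning
    xs⊆U─x : All (T ∘ (U ─ x)) xs
    xs⊆U─x = All.zipWith (λ (x≢y , y∈U) → ∈-─⁺ U (x≢y ∘ sym) y∈U) (x∉xs , xs⊆U)

size-full : ∀ {n} → size (full {n}) ≡ n
size-full {zero}  = refl
size-full {suc n} = cong suc (size-full {n})

module Graphs {n : ℕ} (G : Graph n) where

  adj-sym : ∀ {u v} → Adj G u v → Adj G v u
  adj-sym {u} {v} = subst T (symmetric G u v)

  adj-irrefl : ∀ {u v} → Adj G u v → u ≢ v
  adj-irrefl {u} u~u refl = subst T (irreflex G u) u~u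

  ConnectedOn : Subset n → Set
  ConnectedOn S = ∀ u v → T (S u) → T (S v) → WalkIn G (T ∘ S) u v

  walk-start : ∀ {P u v} → WalkIn G P u v → P u
  walk-start (here u∈P)     = u∈P
  walk-start (step u∈P _ _) = u∈P

  walk-mono : ∀ {P Q : Fin n → Set} → (∀ {x} → P x → Q x) → ∀ {u v} → WalkIn G P u v → WalkIn G Q u v
  walk-mono P⇒Q (here u∈P)       = here (P⇒Q u∈P)
  walk-mono P⇒Q (step u∈P u~w W) = step (P⇒Q u∈P) u~w (walk-mono P⇒Q W)

  walk-∷ʳ : ∀ {P u v w} → WalkIn G P u v → P w → Adj G v w → WalkIn G P u w
  walk-∷ʳ (here u∈P)       w∈P v~w = step u∈P v~w (here w∈P)
  walk-∷ʳ (step u∈P u~x W) w∈P v~w = step u∈P u~x (walk-∷ʳ W w∈P v~w)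

  walk-first-step : ∀ {P u v} → WalkIn G P u v → u ≢ v → ∃[ w ] P w × Adj G u w
  walk-first-step (here _)       u≢u = contradiction refl u≢u
  walk-first-step (step _ u~w W) _   = _ , walk-start W , u~w

  connected-⁅⁆ : ∀ p → ConnectedOn ⁅ p ⁆
  connected-⁅⁆ p u v u∈ v∈ with ∈-∪⁅⁆⁻ ∅ u∈ | ∈-∪⁅⁆⁻ ∅ v∈
  ... | inj₁ refl | inj₁ refl = here u∈

  connected-∪⁅⁆ : ∀ {S ℓ p} → ConnectedOn S → T (S p) → Adj G ℓ p → ConnectedOn (S ∪⁅ ℓ ⁆)
  connected-∪⁅⁆ {S} {ℓ} {p} conn p∈S ℓ~p u v u∈ v∈
    with ∈-∪⁅⁆⁻ S u∈ | ∈-∪⁅⁆⁻ S v∈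
  ... | inj₁ refl | inj₁ refl = here u∈
  ... | inj₁ refl | inj₂ v∈S  = step u∈ ℓ~p (walk-mono (∪⁅⁆-⊇ S ℓ _) (conn p v p∈S v∈S))
  ... | inj₂ u∈S  | inj₁ refl = walk-∷ʳ (walk-mono (∪⁅⁆-⊇ S ℓ _) (conn u p u∈S p∈S)) v∈ (adj-sym ℓ~p)
  ... | inj₂ u∈S  | inj₂ v∈S  = walk-mono (∪⁅⁆-⊇ S ℓ _) (conn u v u∈S v∈S)

  walk-avoiding-leaf : ∀ {S ℓ p} → (∀ {w} → T (S w) → Adj G ℓ w → w ≡ p) →
                       ∀ {u v} → WalkIn G (T ∘ S) u v → u ≢ ℓ → v ≢ ℓ → WalkIn G (T ∘ (S ─ ℓ)) u v
  walk-avoiding-leaf {S} only (here u∈S) u≢ℓ _ = here (∈-─⁺ S u≢ℓ u∈S)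
  walk-avoiding-leaf {S} {ℓ} only (step {w = w} u∈S u~w W) u≢ℓ v≢ℓ with w ≟ ℓ
  ... | no w≢ℓ = step (∈-─⁺ S u≢ℓ u∈S) u~w (walk-avoiding-leaf only W w≢ℓ v≢ℓ)
  walk-avoiding-leaf only (step _ _ (here _)) _ v≢ℓ | yes refl = contradiction refl v≢ℓ
  walk-avoiding-leaf {S} only (step {u = u} u∈S u~ℓ (step {w = w'} _ ℓ~w' W')) u≢ℓ v≢ℓ | yes refl =
    subst (λ x → WalkIn G (T ∘ (S ─ _)) x _) w'≡u (walk-avoiding-leaf only W' (u≢ℓ ∘ trans (sym w'≡u)) v≢ℓ)
    where
    -- the walk enters and leaves the leaf through its only neighbour
    w'≡u : w' ≡ u
    w'≡u = trans (only (walk-start W') ℓ~w') (sym (only u∈S (adj-sym u~ℓ)))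

  connected-─leaf : ∀ {S ℓ p} → ConnectedOn S → (∀ {w} → T (S w) → Adj G ℓ w → w ≡ p) → ConnectedOn (S ─ ℓ)
  connected-─leaf {S} conn only u v u∈ v∈ with ∈-─⁻ S u∈ | ∈-─⁻ S v∈
  ... | u≢ℓ , u∈S | v≢ℓ , v∈S = walk-avoiding-leaf only (conn u v u∈S v∈S) u≢ℓ v≢ℓ

  chain-++⁻ˡ : ∀ xs {ys} → Chain G (xs ++ ys) → Chain G xs
  chain-++⁻ˡ []           _               = nil
  chain-++⁻ˡ (x ∷ [])     _               = one
  chain-++⁻ˡ (x ∷ y ∷ xs) (cons x~y chain) = cons x~y (chain-++⁻ˡ (y ∷ xs) chain)

  lastAdj-∷ʳ : ∀ xs {u y} → Adj G y u → LastAdj G u (xs ∷ʳ y)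
  lastAdj-∷ʳ []           y~u = lst y~u
  lastAdj-∷ʳ (x ∷ [])     y~u = more (lst y~u)
  lastAdj-∷ʳ (x ∷ z ∷ xs) y~u = more (lastAdj-∷ʳ (z ∷ xs) y~u)

  closed-path-is-cycle : ∀ x x' zs {y} → Unique (x ∷ x' ∷ zs ∷ʳ y) → Chain G (x ∷ x' ∷ zs ∷ʳ y) →
                         Adj G y x → IsCycle G (x ∷ x' ∷ zs ∷ʳ y)
  closed-path-is-cycle x x' []       unique chain y~x = unique , chain , lastAdj-∷ʳ (x ∷ x' ∷ []) y~x
  closed-path-is-cycle x x' (z ∷ zs) unique chain y~x = unique , chain , lastAdj-∷ʳ (x ∷ x' ∷ z ∷ zs) y~x

  acyclic⇒no-chord : Acyclic G → ∀ {x x' zs y} → Unique (x ∷ x' ∷ zs) → Chain G (x ∷ x' ∷ zs) →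
                     y ∈ zs → ¬ Adj G y x
  acyclic⇒no-chord acyclic {x} {x'} {zs} {y} unique chain y∈zs y~x
    with pre , post , refl ← ∈-∃++ y∈zs =
    acyclic _ (closed-path-is-cycle x x' pre (Unique-++⁻ˡ cycle (subst Unique path≡ unique))
                                            (chain-++⁻ˡ cycle (subst (Chain G) path≡ chain)) y~x)
    where
    cycle : List (Fin n)
    cycle = x ∷ x' ∷ pre ∷ʳ y
    path≡ : x ∷ x' ∷ pre ++ y ∷ post ≡ cycle ++ post
    path≡ = cong (λ zs → x ∷ x' ∷ zs) (sym (++-assoc pre [ y ] post))

  record IsLeaf (U : Subset n) (ℓ p : Fin n) : Set where
    field
      leaf∈            : T (U ℓ)
      parent∈          : T (U p)
      adjacent         : Adj G ℓ p
      unique-neighbour : ∀ {w} → T (U w) → Adj G ℓ w → w ≡ p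

  -- Extend the path x ∷ x' ∷ zs at x while x has a neighbour in U other than x'; acyclicity
  -- keeps the path simple, so within size U steps x is a leaf.
  longest-path-leaf : Acyclic G → ∀ U k x x' zs → size U ≤ k + length zs →
                      Unique (x ∷ x' ∷ zs) → Chain G (x ∷ x' ∷ zs) → All (T ∘ U) (x ∷ x' ∷ zs) →
                      ∃₂ (IsLeaf U)
  longest-path-leaf acyclic U k x x' zs bound unique chain@(cons x~x' _) path⊆U@(x∈U ∷ x'∈U ∷ _)
    with ∃? (λ y → T? (U y) ×-dec T? (adj G x y) ×-dec ¬? (y ≟ x'))
  ... | no stuck = x , x' , record
    { leaf∈ = x∈U ; parent∈ = x'∈U ; adjacent = x~x'
    ; unique-neighbour = λ {w} w∈U x~w → decidable-stable (w ≟ x') λ w≢x' → stuck (w , w∈U , x~w , w≢x') }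
  ... | yes (y , y∈U , x~y , y≢x') with any? (y ≟_) zs
  ...   | yes y∈zs = contradiction (adj-sym x~y) (acyclic⇒no-chord acyclic unique chain y∈zs)
  ...   | no  y∉zs = extend k bound
    where
    unique' : Unique (y ∷ x ∷ x' ∷ zs)
    unique' = ((adj-irrefl x~y ∘ sym) ∷ y≢x' ∷ ¬Any⇒All¬ zs y∉zs) ∷ unique
    extend : ∀ k → size U ≤ k + length zs → ∃₂ (IsLeaf U)
    extend zero    bound = contradiction (≤-trans (m≤n+m (suc (length zs)) 2)
      (≤-trans (unique⇒length≤size U unique' (y∈U ∷ path⊆U)) bound)) 1+n≰n
    extend (suc k) bound = longest-path-leaf acyclic U k y x (x' ∷ zs) (subst (size U ≤_) (sym (+-suc k _)) bound)
      unique' (cons (adj-sym x~y) chain) (y∈U ∷ path⊆U)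

  leaf-exists : Acyclic G → ∀ {k} U → ConnectedOn U → size U ≡ suc (suc k) → ∃₂ (IsLeaf U)
  leaf-exists acyclic U conn size≡ with size≡suc⇒nonempty U size≡
  ... | u , u∈U with size≡suc⇒nonempty (U ─ u) (suc-injective (trans (sym (size-─ U u u∈U)) size≡))
  ... | v , v∈U─u with ∈-─⁻ U v∈U─u
  ... | v≢u , v∈U with walk-first-step (conn u v u∈U v∈U) (v≢u ∘ sym)
  ... | w , w∈U , u~w =
    longest-path-leaf acyclic U (size U) w u [] (m≤m+n (size U) 0)
      (((adj-irrefl u~w ∘ sym) ∷ []) ∷ [] ∷ []) (cons (adj-sym u~w) one) (w∈U ∷ u∈U ∷ [])

  adjacency : Fin n → Fin n → ℕ
  adjacency u j = if adj G u j then 1 else 0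

  degreeIn : Fin n → Subset n → ℕ
  degreeIn u = chips (adjacency u)

  adjacency≤1 : ∀ u v → adjacency u v ≤ 1
  adjacency≤1 u v with adj G u v
  ... | true  = ≤-refl
  ... | false = z≤n

  adjacency-sym : ∀ u v → adjacency u v ≡ adjacency v u
  adjacency-sym u v = cong (λ b → if b then 1 else 0) (symmetric G u v)

  degreeIn-─self : ∀ u R → T (R u) → degreeIn u R ≡ degreeIn u (R ─ u)
  degreeIn-─self u R u∈R =
    trans (chips-─ (adjacency u) R u u∈R) (cong (λ b → (if b then 1 else 0) + degreeIn u (R ─ u)) (irreflex G u))

  -- Firing the vertices of R in the order L is legal from s: when u fires, R holds u and the
  -- vertices still to fire, and each of u's other neighbours has already given it a chip.
  data FiringOrder (s : Fin n → ℕ) : Subset n → List (Fin n) → Set where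
    done  : ∀ {R} → Empty R → FiringOrder s R []
    fires : ∀ {R u L} → T (R u) → degreeIn u R ≤ s u → FiringOrder s (R ─ u) L → FiringOrder s R (u ∷ L)

  FiringOrder-mono : ∀ {s s' R L} → (∀ i → s i ≤ s' i) → FiringOrder s R L → FiringOrder s' R L
  FiringOrder-mono s≤s' (done empty)           = done empty
  FiringOrder-mono s≤s' (fires u∈R legal rest) = fires u∈R (≤-trans legal (s≤s' _)) (FiringOrder-mono s≤s' rest)

  FiringOrder-∷ʳ : ∀ {s s' R R' L ℓ} → FiringOrder s R L →
                   R ℓ ≡ false → T (R' ℓ) → (∀ i → i ≢ ℓ → R' i ≡ R i) →
                   (∀ u → T (R u) → adjacency u ℓ + s u ≤ s' u) → FiringOrder s' R' (L ∷ʳ ℓ)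
  FiringOrder-∷ʳ {s' = s'} {R' = R'} {ℓ = ℓ} (done empty) ℓ∉R ℓ∈R' agree _ =
    fires ℓ∈R' no-neighbours-left (done R'─ℓ-empty)
    where
    R'─ℓ-empty : Empty (R' ─ ℓ)
    R'─ℓ-empty i with i ≟ ℓ
    ... | yes refl = refl
    ... | no i≢ℓ   = trans (agree i i≢ℓ) (empty i)
    no-neighbours-left : degreeIn ℓ R' ≤ s' ℓ
    no-neighbours-left = subst (_≤ s' ℓ) (sym (trans (degreeIn-─self ℓ R' ℓ∈R') (chips-∅ _ R'─ℓ-empty))) z≤n
  FiringOrder-∷ʳ {s} {s'} {R} {R'} {ℓ = ℓ} (fires {u = u} u∈R legal rest) ℓ∉R ℓ∈R' agree enough =
    fires u∈R' legal' (FiringOrder-∷ʳ rest (trans ([]≔-minimal R ℓ≢u) ℓ∉R) (subst T (sym ([]≔-minimal R' ℓ≢u)) ℓ∈R')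
                                      agree' λ v v∈ → enough v (─-⊆ R u v v∈))
    where
    ℓ≢u : ℓ ≢ u
    ℓ≢u refl = subst T ℓ∉R u∈R
    legal' : degreeIn u R' ≤ s' u
    legal' = begin
      degreeIn u R'                ≡⟨ chips-insert (adjacency u) ℓ ℓ∉R ℓ∈R' agree ⟩
      adjacency u ℓ + degreeIn u R ≤⟨ +-monoʳ-≤ (adjacency u ℓ) legal ⟩
      adjacency u ℓ + s u          ≤⟨ enough u u∈R ⟩
      s' u                         ∎
      where open ≤-Reasoning
    u∈R' : T (R' u)
    u∈R' = subst T (sym (agree u (ℓ≢u ∘ sym))) u∈R
    agree' : ∀ i → i ≢ ℓ → (R' ─ u) i ≡ (R ─ u) i
    agree' i i≢ℓ with i ≟ u
    ... | yes _ = refl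
    ... | no _  = agree i i≢ℓ

  -- x arises from s by firing each vertex outside R once.
  Tracks : (Fin n → ℕ) → Config n → Subset n → Set
  Tracks s x R = ∀ w → lookup x w + degreeIn w R ≡ s w + (if R w then degree G w else 0)

  received : Config n → Fin n → Fin n → ℕ
  received x u w = if adj G u w then suc (lookup x w) else lookup x w

  lookup-fire-self : ∀ x u → lookup (fire G x u) u ≡ lookup x u ∸ degree G u
  lookup-fire-self x u = trans (lookup∘tabulate _ u) ([]≔-updates (received x u) u)

  lookup-fire-other : ∀ x u {w} → w ≢ u → lookup (fire G x u) w ≡ received x u w
  lookup-fire-other x u {w} w≢u = trans (lookup∘tabulate _ w) ([]≔-minimal (received x u) w≢u)

  received-+ : ∀ x u w D → received x u w + D ≡ lookup x w + (adjacency w u + D)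
  received-+ x u w D rewrite symmetric G u w with adj G w u
  ... | true  = sym (+-suc (lookup x w) D)
  ... | false = refl

  tracks⇒legal : ∀ {s x R u} → Tracks s x R → T (R u) → degreeIn u R ≤ s u → degree G u ≤ lookup x u
  tracks⇒legal {s} {x} {R} {u} tracks u∈R legal = +-cancelˡ-≤ (s u) _ _ (begin
    s u + degree G u                     ≡⟨ cong (s u +_) (if-T u∈R) ⟨
    s u + (if R u then degree G u else 0) ≡⟨ tracks u ⟨
    lookup x u + degreeIn u R            ≤⟨ +-monoʳ-≤ (lookup x u) legal ⟩
    lookup x u + s u                     ≡⟨ +-comm (lookup x u) (s u) ⟩
    s u + lookup x u                     ∎)
    where open ≤-Reasoning

  tracks-fire : ∀ {s x R u} → Tracks s x R → T (R u) → degree G u ≤ lookup x u →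
                Tracks s (fire G x u) (R ─ u)
  tracks-fire {s} {x} {R} {u} tracks u∈R deg≤ w with w ≟ u
  ... | yes refl = begin
    lookup (fire G x u) u + degreeIn u (R ─ u)
      ≡⟨ cong₂ _+_ (lookup-fire-self x u) (sym (degreeIn-─self u R u∈R)) ⟩
    lookup x u ∸ degree G u + degreeIn u R
      ≡⟨ ∸-+-cancel deg≤ (trans (tracks u) (cong (s u +_) (if-T u∈R))) ⟩
    s u
      ≡⟨ +-identityʳ (s u) ⟨
    s u + 0 ∎
    where open ≡-Reasoning
  ... | no w≢u = begin
    lookup (fire G x u) w + degreeIn w (R ─ u)       ≡⟨ cong (_+ _) (lookup-fire-other x u w≢u) ⟩
    received x u w + degreeIn w (R ─ u)                 ≡⟨ received-+ x u w _ ⟩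
    lookup x w + (adjacency w u + degreeIn w (R ─ u)) ≡⟨ cong (lookup x w +_) (chips-─ (adjacency w) R u u∈R) ⟨
    lookup x w + degreeIn w R                        ≡⟨ tracks w ⟩
    s w + (if R w then degree G w else 0)            ∎
    where open ≡-Reasoning

  tracks-∅ : ∀ {s x R} → Empty R → Tracks s x R → x ≡ tabulate s
  tracks-∅ {s} {x} {R} empty tracks = trans (sym (tabulate∘lookup x)) (tabulate-cong λ w → begin
    lookup x w                            ≡⟨ +-identityʳ (lookup x w) ⟨
    lookup x w + 0                        ≡⟨ cong (lookup x w +_) (chips-∅ (adjacency w) empty) ⟨
    lookup x w + degreeIn w R             ≡⟨ tracks w ⟩
    s w + (if R w then degree G w else 0) ≡⟨ cong (λ b → s w + (if b then degree G w else 0)) (empty w) ⟩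
    s w + 0                               ≡⟨ +-identityʳ (s w) ⟩
    s w                                   ∎)
    where open ≡-Reasoning

  fire-all : ∀ {s x R u L} → FiringOrder s R (u ∷ L) → Tracks s x R → TransClosure (LegalFire G) x (tabulate s)
  fire-all {s} {x} {R} {u} {L} (fires u∈R legal rest) tracks = continue rest (tracks-fire {s} {x} {R} tracks u∈R deg≤)
    where
    deg≤ : degree G u ≤ lookup x u
    deg≤ = tracks⇒legal {s} {x} {R} tracks u∈R legal
    continue : ∀ {L} → FiringOrder s (R ─ u) L → Tracks s (fire G x u) (R ─ u) →
               TransClosure (LegalFire G) x (tabulate s)
    continue (done empty)       tracks' = subst (TransClosure _ x) (tracks-∅ {s} empty tracks') Plus.[ fireAt u deg≤ ]
    continue rest@(fires _ _ _) tracks' = fireAt u deg≤ ∷ fire-all rest tracks'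

  firingOrder⇒selfReachable : ∀ {s L} → Fin n → FiringOrder s full L → SelfReachable G (tabulate s)
  firingOrder⇒selfReachable v (done empty)        = contradiction (empty v) λ ()
  firingOrder⇒selfReachable {s} v fo@(fires _ _ _) = fire-all fo λ w → cong (_+ degree G w) (lookup∘tabulate s w)

  DilatedOn : ℕ → Subset n → (Fin n → ℕ) → Set
  DilatedOn k U f = ∀ S → S ⊆ U → IsSubtree G S → k * (size S ∸ 1) ≤ chips f S

  DilatedOn-⊆ : ∀ {k U U' f} → U' ⊆ U → DilatedOn k U f → DilatedOn k U' f
  DilatedOn-⊆ U'⊆U dilated S S⊆U' = dilated S λ i → U'⊆U i ∘ S⊆U' i

  module _ {U ℓ p} (leaf : IsLeaf U ℓ p) where
    open IsLeaf leaf

    p≢ℓ : p ≢ ℓ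
    p≢ℓ = adj-irrefl adjacent ∘ sym

    ─leaf-⊆ : ∀ {S} → S ⊆ U → ¬ T (S ℓ) → S ⊆ U ─ ℓ
    ─leaf-⊆ S⊆U ℓ∉S i i∈S = ∈-─⁺ U (λ { refl → ℓ∉S i∈S }) (S⊆U i i∈S)

    adjacency-leaf : ∀ {u} → T (U u) → u ≢ p → adjacency ℓ u ≡ 0
    adjacency-leaf {u} u∈U u≢p with adj G ℓ u in ℓ~u
    ... | false = refl
    ... | true  = contradiction (unique-neighbour u∈U (Equivalence.from T-≡ ℓ~u)) u≢p

    leaf-degree≤1 : degreeIn ℓ U ≤ 1
    leaf-degree≤1 = ≤-reflexive (begin
      degreeIn ℓ U                       ≡⟨ chips-─ (adjacency ℓ) U p parent∈ ⟩
      adjacency ℓ p + degreeIn ℓ (U ─ p) ≡⟨ cong₂ _+_ (if-T adjacent) (chips-vanishing _ (U ─ p) other) ⟩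
      1                                  ∎)
      where
      open ≡-Reasoning
      other : ∀ i → T ((U ─ p) i) → adjacency ℓ i ≡ 0
      other i i∈ = let i≢p , i∈U = ∈-─⁻ U i∈ in adjacency-leaf i∈U i≢p

    parent∈subtree : ∀ {S v} → S ⊆ U → ConnectedOn S → T (S ℓ) → T (S v) → v ≢ ℓ → T (S p)
    parent∈subtree S⊆U conn ℓ∈S v∈S v≢ℓ with walk-first-step (conn _ _ ℓ∈S v∈S) (v≢ℓ ∘ sym)
    ... | w , w∈S , ℓ~w = subst (T ∘ _) (unique-neighbour (S⊆U w w∈S) ℓ~w) w∈S

    DilatedOn-∪leaf : ∀ {k c S} → DilatedOn k U c → S ⊆ U ─ ℓ → IsSubtree G S → T (S p) →
                      k * size S ≤ c ℓ + chips c S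
    DilatedOn-∪leaf {k} {c} {S} dilated S⊆U─ℓ (_ , conn) p∈S =
      subst₂ (λ m x → k * (m ∸ 1) ≤ x) (chips-insert _ ℓ ℓ∉S (∈-∪⁅⁆ S ℓ) agree) (chips-insert c ℓ ℓ∉S (∈-∪⁅⁆ S ℓ) agree)
        (dilated (S ∪⁅ ℓ ⁆) S∪ℓ⊆U ((ℓ , ∈-∪⁅⁆ S ℓ) , connected-∪⁅⁆ conn p∈S adjacent))
      where
      ℓ∉S : S ℓ ≡ false
      ℓ∉S with S ℓ in ℓ∈S
      ... | false = refl
      ... | true  = contradiction refl (proj₁ (∈-─⁻ U (S⊆U─ℓ ℓ (Equivalence.from T-≡ ℓ∈S))))
      agree : ∀ i → i ≢ ℓ → (S ∪⁅ ℓ ⁆) i ≡ S i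
      agree i = []≔-minimal S
      S∪ℓ⊆U : S ∪⁅ ℓ ⁆ ⊆ U
      S∪ℓ⊆U i i∈ with ∈-∪⁅⁆⁻ S i∈
      ... | inj₁ refl = leaf∈
      ... | inj₂ i∈S  = ─-⊆ U ℓ i (S⊆U─ℓ i i∈S)

    DilatedOn-extend : ∀ {k d' d} → DilatedOn k (U ─ ℓ) d' → (∀ i → i ≢ ℓ → d' i ≤ d i) →
                       (∀ S → T (S ℓ) → T (S p) → k + chips d' (S ─ ℓ) ≤ chips d S) →
                       DilatedOn k U d
    DilatedOn-extend {k} {d'} {d} dilated' d'≤d gain S S⊆U subtree@(_ , conn) with T? (S ℓ)
    ... | no ℓ∉S = ≤-trans (dilated' S (─leaf-⊆ S⊆U ℓ∉S) subtree)
                           (chips-monoˡ S λ i i∈S → d'≤d i λ { refl → ℓ∉S i∈S })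
    ... | yes ℓ∈S with size (S ─ ℓ) in size≡
    ...   | zero  = m≤1⇒k*[m∸1]≤n k _ (≤-reflexive (trans (size-─ S ℓ ℓ∈S) (cong suc size≡)))
    ...   | suc j with size≡suc⇒nonempty (S ─ ℓ) size≡
    ...     | v , v∈S─ℓ = begin
      k * (size S ∸ 1)     ≡⟨ cong (λ m → k * (m ∸ 1)) (trans (size-─ S ℓ ℓ∈S) (cong suc size≡)) ⟩
      k * suc j            ≡⟨ *-suc k j ⟩
      k + k * j            ≤⟨ +-monoʳ-≤ k (subst (λ m → k * (m ∸ 1) ≤ chips d' (S ─ ℓ)) size≡ (dilated' (S ─ ℓ) S─ℓ⊆U─ℓ subtree')) ⟩
      k + chips d' (S ─ ℓ) ≤⟨ gain S ℓ∈S (parent∈subtree S⊆U conn ℓ∈S (proj₂ (∈-─⁻ S v∈S─ℓ)) (proj₁ (∈-─⁻ S v∈S─ℓ))) ⟩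
      chips d S            ∎
      where
      open ≤-Reasoning
      S─ℓ⊆U─ℓ : S ─ ℓ ⊆ U ─ ℓ
      S─ℓ⊆U─ℓ i i∈ = ∈-─⁺ U (proj₁ (∈-─⁻ S i∈)) (S⊆U i (proj₂ (∈-─⁻ S i∈)))
      subtree' : IsSubtree G (S ─ ℓ)
      subtree' = (v , v∈S─ℓ) , connected-─leaf conn λ w∈S ℓ~w → unique-neighbour (S⊆U _ w∈S) ℓ~w

module Peeling {n : ℕ} (G : Graph n) (acyclic : Acyclic G) (t : ℕ) where
  open Graphs G

  record Splitting (U : Subset n) (c : Fin n → ℕ) : Set where
    field
      s d       : Fin n → ℕ
      s+d≡c     : ∀ i → s i + d i ≡ c i
      s-outside : ∀ i → U i ≡ false → s i ≡ 0
      size≡     : size U ≡ suc (ΣV s)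
      d-dilated : DilatedOn t U d
      order     : List (Fin n)
      s-fires   : FiringOrder s U order

  splitting-single : ∀ {U} c → size U ≡ 1 → Splitting U c
  splitting-single {U} c size≡1 with size≡suc⇒nonempty U size≡1
  ... | u , u∈U = record
    { s         = λ _ → 0
    ; d         = c
    ; s+d≡c     = λ _ → refl
    ; s-outside = λ _ _ → refl
    ; size≡     = trans size≡1 (cong suc (sym (sum-replicate-zero n)))
    ; d-dilated = λ S S⊆U _ → m≤1⇒k*[m∸1]≤n t _ (subst (size S ≤_) size≡1 (chips-monoʳ _ S⊆U))
    ; order     = u ∷ []
    ; s-fires   = fires u∈U (≤-reflexive (trans (degreeIn-─self u U u∈U) (chips-∅ _ U─u-empty)))
                        (done U─u-empty)
    }
    where
    U─u-empty : Empty (U ─ u)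
    U─u-empty = size≡0⇒Empty (U ─ u) (suc-injective (trans (sym (size-─ U u u∈U)) size≡1))

  module _ {U ℓ p} (leaf : IsLeaf U ℓ p) where
    open IsLeaf leaf

    size-raise : ∀ {s' : Fin n → ℕ} {q} → size (U ─ ℓ) ≡ suc (ΣV s') → size U ≡ suc (ΣV (raise s' q 1))
    size-raise {s'} {q} size≡ =
      trans (size-─ U ℓ leaf∈) (cong suc (trans size≡ (sym (chips-raise s' full q 1 _))))

    raise-outside : ∀ {s' : Fin n → ℕ} {q} → T (U q) → (∀ i → (U ─ ℓ) i ≡ false → s' i ≡ 0) →
                    ∀ i → U i ≡ false → raise s' q 1 i ≡ 0
    raise-outside {s'} {q} q∈U outside i i∉U with i ≟ q
    ... | yes refl = ⊥-elim (subst T i∉U q∈U)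
    ... | no _     = outside i (trans ([]≔-minimal U λ { refl → subst T i∉U leaf∈ }) i∉U)

    keep-chip : ∀ {c m} → c ℓ ≡ suc m → t ≤ m → Splitting (U ─ ℓ) c → Splitting U c
    keep-chip {c} {m} cℓ≡ t≤m split = record
      { s         = raise s' ℓ 1
      ; d         = d' [ ℓ ]≔ m
      ; s+d≡c     = s+d≡c
      ; s-outside = raise-outside leaf∈ s'-outside
      ; size≡     = size-raise size≡'
      ; d-dilated = DilatedOn-extend leaf d'-dilated (λ i i≢ℓ → ≤-reflexive (sym ([]≔-minimal d' i≢ℓ))) gain
      ; order     = ℓ ∷ order'
      ; s-fires   = fires leaf∈ (≤-trans (leaf-degree≤1 leaf) (subst (1 ≤_) (sym ([]≔-updates s' ℓ)) (s≤s z≤n)))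
                          (FiringOrder-mono (raise-≥ s' ℓ 1) s'-fires)
      }
      where
      open Splitting split renaming (s to s'; d to d'; s+d≡c to s'+d'≡c; s-outside to s'-outside;
                                     size≡ to size≡'; d-dilated to d'-dilated; order to order'; s-fires to s'-fires)
      s+d≡c : ∀ i → raise s' ℓ 1 i + (d' [ ℓ ]≔ m) i ≡ c i
      s+d≡c i with i ≟ ℓ
      ... | yes refl = trans (cong (λ x → suc x + m) (s'-outside ℓ (∉-─ U ℓ))) (sym cℓ≡)
      ... | no _     = s'+d'≡c i
      gain : ∀ S → T (S ℓ) → T (S p) → t + chips d' (S ─ ℓ) ≤ chips (d' [ ℓ ]≔ m) S
      gain S ℓ∈S _ = subst (t + chips d' (S ─ ℓ) ≤_) (sym (chips-[]≔ d' S ℓ ℓ∈S)) (+-monoˡ-≤ _ t≤m)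

    pass-chips : ∀ {c r E} → c ℓ + r ≡ t → c p ≡ suc (r + E) → Splitting (U ─ ℓ) (c [ p ]≔ E) → Splitting U c
    pass-chips {c} {r} {E} cℓ+r≡t cp≡ split = record
      { s         = raise s' p 1
      ; d         = raise d' p r
      ; s+d≡c     = s+d≡c
      ; s-outside = raise-outside parent∈ s'-outside
      ; size≡     = size-raise size≡'
      ; d-dilated = DilatedOn-extend leaf d'-dilated (λ i _ → raise-≥ d' p r i) gain
      ; order     = order' ∷ʳ ℓ
      ; s-fires   = FiringOrder-∷ʳ s'-fires (∉-─ U ℓ) leaf∈ (λ i i≢ℓ → sym ([]≔-minimal U i≢ℓ)) enough
      }
      where
      open Splitting split renaming (s to s'; d to d'; s+d≡c to s'+d'≡c; s-outside to s'-outside;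
                                     size≡ to size≡'; d-dilated to d'-dilated; order to order'; s-fires to s'-fires)
      s+d≡c : ∀ i → raise s' p 1 i + raise d' p r i ≡ c i
      s+d≡c i with i ≟ p
      ... | yes refl = begin
        suc (s' p + (r + d' p)) ≡⟨ cong suc (x∙yz≈y∙xz (s' p) r (d' p)) ⟩
        suc (r + (s' p + d' p)) ≡⟨ cong (λ x → suc (r + x)) (trans (s'+d'≡c p) ([]≔-updates c p)) ⟩
        suc (r + E)             ≡⟨ cp≡ ⟨
        c p                     ∎
        where open ≡-Reasoning
      ... | no i≢p   = trans (s'+d'≡c i) ([]≔-minimal c i≢p)
      d'ℓ≡cℓ : d' ℓ ≡ c ℓ
      d'ℓ≡cℓ = begin
        d' ℓ         ≡⟨ cong (_+ d' ℓ) (s'-outside ℓ (∉-─ U ℓ)) ⟨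
        s' ℓ + d' ℓ  ≡⟨ s'+d'≡c ℓ ⟩
        (c [ p ]≔ E) ℓ ≡⟨ []≔-minimal c (p≢ℓ leaf ∘ sym) ⟩
        c ℓ          ∎
        where open ≡-Reasoning
      gain : ∀ S → T (S ℓ) → T (S p) → t + chips d' (S ─ ℓ) ≤ chips (raise d' p r) S
      gain S ℓ∈S p∈S = ≤-reflexive (begin
        t + chips d' (S ─ ℓ)                              ≡⟨ cong (_+ chips d' (S ─ ℓ)) cℓ+r≡t ⟨
        c ℓ + r + chips d' (S ─ ℓ)                        ≡⟨ +-assoc (c ℓ) r _ ⟩
        c ℓ + (r + chips d' (S ─ ℓ))                      ≡⟨ cong₂ _+_ (trans (sym d'ℓ≡cℓ) (sym ([]≔-minimal d' (p≢ℓ leaf ∘ sym))))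
                                                                       (sym (chips-raise d' (S ─ ℓ) p r (∈-─⁺ S (p≢ℓ leaf) p∈S))) ⟩
        raise d' p r ℓ + chips (raise d' p r) (S ─ ℓ)     ≡⟨ chips-─ _ S ℓ ℓ∈S ⟨
        chips (raise d' p r) S                            ∎)
        where open ≡-Reasoning
      enough : ∀ u → T ((U ─ ℓ) u) → adjacency u ℓ + s' u ≤ raise s' p 1 u
      enough u u∈ with u ≟ p
      ... | yes refl = +-monoˡ-≤ (s' p) (adjacency≤1 p ℓ)
      ... | no u≢p   = ≤-reflexive (cong (_+ s' u) (trans (adjacency-sym u ℓ) (adjacency-leaf leaf (proj₂ (∈-─⁻ U u∈)) u≢p)))

    leaf-pair-bound : ∀ {c} → DilatedOn (t + 1) U c → t + 1 ≤ c ℓ + c p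
    leaf-pair-bound {c} dilated =
      subst₂ _≤_ (trans (cong ((t + 1) *_) (chips-⁅⁆ _ p)) (*-identityʳ (t + 1))) (cong (c ℓ +_) (chips-⁅⁆ c p))
        (DilatedOn-∪leaf leaf {t + 1} dilated ⁅p⁆⊆U─ℓ ((p , ∈-∪⁅⁆ ∅ p) , connected-⁅⁆ p) (∈-∪⁅⁆ ∅ p))
      where
      ⁅p⁆⊆U─ℓ : ⁅ p ⁆ ⊆ U ─ ℓ
      ⁅p⁆⊆U─ℓ i i∈ with ∈-∪⁅⁆⁻ ∅ i∈
      ... | inj₁ refl = ∈-─⁺ U (p≢ℓ leaf) parent∈

    parent-surplus : ∀ {c r} → c ℓ + r ≡ t → DilatedOn (t + 1) U c → ∃[ E ] c p ≡ suc (r + E)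
    parent-surplus {c} {r} cℓ+r≡t dilated =
      let E , r+E≡ = m≤n⇒∃[o]m+o≡n (+-cancelˡ-≤ (c ℓ) (suc r) (c p) bound) in E , sym r+E≡
      where
      bound : c ℓ + suc r ≤ c ℓ + c p
      bound = subst (_≤ c ℓ + c p) (trans (cong (_+ 1) (sym cℓ+r≡t)) (trans (+-assoc (c ℓ) r 1) (cong (c ℓ +_) (+-comm r 1))))
                (leaf-pair-bound dilated)

    DilatedOn-pass : ∀ {c r E} → c ℓ + r ≡ t → c p ≡ suc (r + E) →
                     DilatedOn (t + 1) U c → DilatedOn (t + 1) (U ─ ℓ) (c [ p ]≔ E)
    DilatedOn-pass {c} {r} {E} cℓ+r≡t cp≡ dilated S S⊆U─ℓ subtree with T? (S p)
    ... | no p∉S  = subst ((t + 1) * (size S ∸ 1) ≤_)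
                          (chips-congˡ S λ i i∈S → sym ([]≔-minimal c λ { refl → p∉S i∈S }))
                          (dilated S (λ i → ─-⊆ U ℓ i ∘ S⊆U─ℓ i) subtree)
    ... | yes p∈S = +-cancelˡ-≤ (t + 1) _ _ (begin
      t + 1 + (t + 1) * (size S ∸ 1)          ≡⟨ cong (λ m → t + 1 + (t + 1) * (m ∸ 1)) (size-─ S p p∈S) ⟩
      t + 1 + (t + 1) * size (S ─ p)          ≡⟨ *-suc (t + 1) _ ⟨
      (t + 1) * suc (size (S ─ p))            ≡⟨ cong ((t + 1) *_) (size-─ S p p∈S) ⟨
      (t + 1) * size S                        ≤⟨ DilatedOn-∪leaf leaf {t + 1} dilated S⊆U─ℓ subtree p∈S ⟩
      c ℓ + chips c S                         ≡⟨ cong (c ℓ +_) (chips-─ c S p p∈S) ⟩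
      c ℓ + (c p + chips c (S ─ p))           ≡⟨ cong (λ x → c ℓ + (x + chips c (S ─ p))) cp≡ ⟩
      c ℓ + (suc (r + E) + chips c (S ─ p))   ≡⟨ rearrange (c ℓ) r E _ ⟩
      c ℓ + r + 1 + (E + chips c (S ─ p))     ≡⟨ cong (λ x → x + 1 + (E + chips c (S ─ p))) cℓ+r≡t ⟩
      t + 1 + (E + chips c (S ─ p))           ≡⟨ cong (t + 1 +_) (chips-[]≔ c S p p∈S) ⟨
      t + 1 + chips (c [ p ]≔ E) S            ∎)
      where
      open ≤-Reasoning
      rearrange : ∀ a r E X → a + (suc (r + E) + X) ≡ a + r + 1 + (E + X)
      rearrange = solve-∀

    peel : (∀ c → DilatedOn (t + 1) (U ─ ℓ) c → Splitting (U ─ ℓ) c) →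
           ∀ c → DilatedOn (t + 1) U c → Splitting U c
    peel split c dilated with c ℓ ≤? t
    ... | yes cℓ≤t =
      let r , cℓ+r≡t = m≤n⇒∃[o]m+o≡n cℓ≤t
          E , cp≡    = parent-surplus cℓ+r≡t dilated
      in pass-chips cℓ+r≡t cp≡ (split (c [ p ]≔ E) (DilatedOn-pass cℓ+r≡t cp≡ dilated))
    ... | no cℓ≰t with c ℓ in cℓ≡ | ≰⇒> cℓ≰t
    ...   | suc m | s≤s t≤m = keep-chip cℓ≡ t≤m (split c (DilatedOn-⊆ {t + 1} (─-⊆ U ℓ) dilated))

  splitting : ∀ k {U} → size U ≡ suc k → ConnectedOn U → ∀ c → DilatedOn (t + 1) U c → Splitting U c
  splitting zero          size≡ _    c _ = splitting-single c size≡
  splitting (suc k) {U} size≡ conn =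
    let ℓ , p , leaf = leaf-exists acyclic U conn size≡
        open IsLeaf leaf
    in peel leaf (splitting k (suc-injective (trans (sym (size-─ U ℓ leaf∈)) size≡))
                              (connected-─leaf conn unique-neighbour))

tabulate-≤ᶜ : ∀ {n} (c : Config n) {s d : Fin n → ℕ} → (∀ i → s i + d i ≡ lookup c i) → tabulate s ≤ᶜ c
tabulate-≤ᶜ c {s} {d} s+d≡c i =
  subst (_≤ lookup c i) (sym (lookup∘tabulate s i)) (subst (s i ≤_) (s+d≡c i) (m≤m+n (s i) (d i)))

lookup-∸-tabulate : ∀ {n} (c : Config n) {s d : Fin n → ℕ} → (∀ i → s i + d i ≡ lookup c i) →
                    ∀ i → lookup (c -ᶜ tabulate s) i ≡ d i
lookup-∸-tabulate c {s} {d} s+d≡c i = begin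
  lookup (c -ᶜ tabulate s) i         ≡⟨ lookup-zipWith _∸_ i c (tabulate s) ⟩
  lookup c i ∸ lookup (tabulate s) i ≡⟨ cong (lookup c i ∸_) (lookup∘tabulate s i) ⟩
  lookup c i ∸ s i                   ≡⟨ cong (_∸ s i) (s+d≡c i) ⟨
  s i + d i ∸ s i                    ≡⟨ m+n∸m≡n (s i) (d i) ⟩
  d i                                ∎
  where open ≡-Reasoning

lemma4p7 : (n : ℕ) → 1 ≤ n → (G : Graph n) → IsTree G →
    (t : ℕ) → 1 ≤ t → (c : Config n) → Dilated (t + 1) G c →
    ∃[ s ] (MinSelfReachable G s × s ≤ᶜ c × Dilated t G (c -ᶜ s))
-- The argument does not need t ≥ 1.
lemma4p7 (suc m) _ G (connected , acyclic) t _ c dilated =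
  tabulate s ,
  (firingOrder⇒selfReachable fzero s-fires , trans (sum-cong-≗ (lookup∘tabulate s)) total≡m) ,
  tabulate-≤ᶜ c {s} {d} s+d≡c ,
  λ S subtree → subst (t * (size S ∸ 1) ≤_) (chips-congˡ S λ i _ → sym (lookup-∸-tabulate c {s} {d} s+d≡c i))
                      (d-dilated S (λ _ _ → _) subtree)
  where
  open Graphs G
  open Peeling G acyclic t
  open Splitting (splitting m size-full (λ u v _ _ → connected u v) (lookup c) λ S _ → dilated S)
  total≡m : ΣV s ≡ m
  total≡m = suc-injective (trans (sym size≡) size-full)
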